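{- Let $\mathbf{m}=(m_1,\dots,m_n)$ be a tuple of nonnegative integers and $\gamma=m_1+\dots+m_n$. (1) If $m_1,\dots,m_n$ are not all equal, let $k$ be an index with $m_k=\max\{m_1,\dots,m_n\}$, let $C=\{j: m_j=m_k\}$ and $c=|C|$, and let $B^{(1)}=(b_{i,j})$ be the $\gamma\times n$ matrix with $b_{\gamma,j}=1-\frac{\gamma}{c\,m_k}$ for $j\in C$ and all other entries equal to $1$. Then $\operatorname{mperm}_{\mathbf{m}}(B^{(1)})=0$. (2) If $m_1=\cdots=m_n=m$ with $m\geq 1$, let $B^{(2)}=(b_{i,j})$ be the $\gamma\times n$ matrix with $b_{1,1}=1-n$ and all other entries equal to $1$. Then $\operatorname{mperm}_{\mathbf{m}}(B^{(2)})=0$.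
   Context: $\operatorname{mperm}_{\mathbf{m}}=\sum_{\sigma\in\Sigma_{\mathbf{m}}}\prod_{i=1}^{\gamma}x_{i,\sigma(i)}$ in the variables $x_{i,j}$ ($1\le i\le\gamma$, $1\le j\le n$), where $\Sigma_{\mathbf{m}}$ is the set of functions $\sigma:\{1,\dots,\gamma\}\to\{1,\dots,n\}$ with $|\sigma^{ -1}(j)|=m_j$ for each $j$; it is evaluated at a $\gamma\times n$ matrix by substituting its $(i,j)$ entry for $x_{i,j}$. -}

module Defs where

open import Data.Nat as ℕ using (ℕ; zero; suc; _≤_)
open import Data.Fin as Fin using (Fin; toℕ)
open import Data.List using (List; []; _∷_; map; concatMap; filter; length; allFin; foldr)
open import Data.Integer using (+_)
open import Data.Rational as ℚ using (ℚ; 0ℚ; 1ℚ)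
open import Relation.Nullary.Decidable using (Dec; yes; no; _×-dec_)
open import Data.Fin.Properties using (all?)
open import Relation.Binary.PropositionalEquality using (_≡_)
open import Data.Nat.ListAction using (sum)

-- rational a / d, with the (never used) convention a / 0 = 0
divℕ : ℕ → ℕ → ℚ
divℕ a zero    = 0ℚ
divℕ a (suc d) = (+ a) ℚ./ suc d

fromℕ : ℕ → ℚ
fromℕ a = (+ a) ℚ./ 1

gamma : {n : ℕ} → (Fin n → ℕ) → ℕ
gamma {n} m = sum (map m (allFin n))

extend : {g n : ℕ} → Fin n → (Fin g → Fin n) → Fin (suc g) → Fin n
extend x f Fin.zero    = x
extend x f (Fin.suc i) = f i

allFuns : (g n : ℕ) → List (Fin g → Fin n)
allFuns zero    n = (λ ()) ∷ []
allFuns (suc g) n = concatMap (λ f → map (λ x → extend x f) (allFin n)) (allFuns g n)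

fiberSize : {g n : ℕ} → (Fin g → Fin n) → Fin n → ℕ
fiberSize {g} σ j = length (filter (λ i → σ i Fin.≟ j) (allFin g))

inSigma? : {n : ℕ} (m : Fin n → ℕ) (σ : Fin (gamma m) → Fin n) →
           Dec (∀ j → fiberSize σ j ≡ m j)
inSigma? m σ = all? (λ j → fiberSize σ j ℕ.≟ m j)

SigmaM : {n : ℕ} (m : Fin n → ℕ) → List (Fin (gamma m) → Fin n)
SigmaM {n} m = filter (inSigma? m) (allFuns (gamma m) n)

sumℚ : List ℚ → ℚ
sumℚ = foldr ℚ._+_ 0ℚ

prodℚ : List ℚ → ℚ
prodℚ = foldr ℚ._*_ 1ℚ

mperm : {n : ℕ} (m : Fin n → ℕ) → (Fin (gamma m) → Fin n → ℚ) → ℚ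
mperm m X = sumℚ (map (λ σ → prodℚ (map (λ i → X i (σ i)) (allFin (gamma m)))) (SigmaM m))

AllEqual : {n : ℕ} → (Fin n → ℕ) → Set
AllEqual m = ∀ i j → m i ≡ m j

cCount : {n : ℕ} (m : Fin n → ℕ) (k : Fin n) → ℕ
cCount {n} m k = length (filter (λ j → m j ℕ.≟ m k) (allFin n))

-- B⁽¹⁾: b_{γ,j} = 1 - γ/(c m_k) for j ∈ C, all other entries 1
-- (row i is the last row γ iff toℕ i + 1 = γ)
B1 : {n : ℕ} (m : Fin n → ℕ) (k : Fin n) → Fin (gamma m) → Fin n → ℚ
B1 m k i j with (suc (toℕ i) ℕ.≟ gamma m) ×-dec (m j ℕ.≟ m k)
... | yes _ = 1ℚ ℚ.- divℕ (gamma m) (cCount m k ℕ.* m k)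
... | no  _ = 1ℚ

B2 : {n : ℕ} (m : Fin n → ℕ) → Fin (gamma m) → Fin n → ℚ
B2 {n} m i j with (toℕ i ℕ.≟ 0) ×-dec (toℕ j ℕ.≟ 0)
... | yes _ = 1ℚ ℚ.- fromℕ n
... | no  _ = 1ℚ

{-# OPTIONS --safe #-}
-- Both matrices are the all-ones matrix outside a single row i₀, whose entries have the form
-- 1 − a·w_j with w_j ∈ {0, 1}.  Expanding the product along that row gives
--   mperm_m = |Σ_m| − a · Σ_{σ ∈ Σ_m} w_{σ(i₀)}.
-- By symmetry every row of σ takes the value j for a fraction m_j/γ of Σ_m, i.e.
--   γ · Σ_{σ ∈ Σ_m} w_{σ(i₀)} = (Σ_j m_j w_j) · |Σ_m|,
-- so the permanent vanishes as soon as a = γ / Σ_j m_j w_j.  In (1) w is the indicator of C and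
-- Σ_j m_j w_j = c·m_k; in (2) w is the indicator of the first column and the ratio is γ/m = n.
-- The symmetry identity is proved by induction on γ, splitting σ at its first row and using
-- the multinomial formula |Σ_m| · ∏_j m_j! = γ!.

module Submission where

open import Defs
open import Function using (_∘_)
open import Data.Bool using (true; false; if_then_else_)
open import Data.Nat as ℕ using (ℕ; zero; suc; _+_; _*_; _≤_; _!; pred; NonZero)
import Data.Nat.Properties as ℕP
open import Data.Nat.ListAction using (sum)
import Data.Nat.ListAction.Properties as ListSum
open import Data.Nat.Solver using (module +-*-Solver)
open import Data.Fin as Fin using (Fin; toℕ; punchIn)
import Data.Fin.Properties as FinP
open import Data.List using (List; []; _∷_; _++_; map; concatMap; filter; length; tabulate; allFin)
open import Data.List.Properties using (map-++; map-cong; map-tabulate)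
open import Data.Vec.Functional using (Vector; updateAt; removeAt)
open import Data.Vec.Functional.Properties using (updateAt-updates; updateAt-minimal)
open import Data.Product using (Σ; _,_; _×_; proj₁; proj₂)
import Data.Integer as ℤ
import Data.Integer.Properties as ℤP
open import Data.Rational as ℚ using (ℚ; 0ℚ; 1ℚ; fromℚᵘ)
import Data.Rational.Properties as ℚP
open import Data.Rational.Unnormalised as ℚᵘ using (mkℚᵘ; *≡*)
import Data.Rational.Unnormalised.Properties as ℚᵘP
open import Data.Rational.Solver using () renaming (module +-*-Solver to ℚ-Solver)
open import Algebra.Bundles using (CommutativeMonoid)
import Algebra.Properties.CommutativeMonoid.Sum as MonoidSum
open import Algebra.Properties.Semiring.Sum ℕP.+-*-semiring
  using (sum-syntax; ∑-distrib-+; *-distribˡ-sum; *-distribʳ-sum; sum-cong-≗; sum-remove; sum-replicate-zero)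
open MonoidSum ℕP.*-1-commutativeMonoid using ()
  renaming (sum to ∏; sum-cong-≗ to ∏-cong-≗; sum-replicate-zero to ∏-replicate-1)
open import Algebra.Properties.CommutativeSemigroup ℕP.*-commutativeSemigroup
  using (x∙yz≈y∙xz; xy∙z≈xz∙y; xy∙z≈zx∙y)
open import Relation.Nullary using (Dec; yes; no; does; ¬_; contradiction)
open import Relation.Nullary.Decidable using (_×-dec_)
open import Relation.Unary using (Decidable)
open import Relation.Binary.PropositionalEquality
  using (_≡_; _≢_; _≗_; refl; sym; trans; cong; cong₂; subst; module ≡-Reasoning)

private variable
  A B : Set
  P : A → Set
  g n : ℕ

𝟙 : Dec A → ℕ
𝟙 d = if does d then 1 else 0

𝟙-yes : (d : Dec A) → A → 𝟙 d ≡ 1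
𝟙-yes (yes _) _ = refl
𝟙-yes (no ¬a) a = contradiction a ¬a

𝟙-no : (d : Dec A) → ¬ A → 𝟙 d ≡ 0
𝟙-no (yes a) ¬a = contradiction a ¬a
𝟙-no (no _)  _  = refl

𝟙-cong : (A → B) → (B → A) → (d : Dec A) (e : Dec B) → 𝟙 d ≡ 𝟙 e
𝟙-cong to from (yes a) e = sym (𝟙-yes e (to a))
𝟙-cong to from (no ¬a) e = sym (𝟙-no e (¬a ∘ from))

[_≢0] : ℕ → ℕ
[ k ≢0] = 𝟙 (ℕP.nonZero? k)

¬NonZero⇒≡0 : {k : ℕ} → ¬ NonZero k → k ≡ 0
¬NonZero⇒≡0 {zero}  _     = refl
¬NonZero⇒≡0 {suc k} ¬k≢0 = contradiction _ ¬k≢0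

sum-map-cong : {F G : A → ℕ} → (∀ a → F a ≡ G a) → (L : List A) → sum (map F L) ≡ sum (map G L)
sum-map-cong F≗G L = cong sum (map-cong F≗G L)

sum-map-*ˡ : (c : ℕ) (F : A → ℕ) (L : List A) → sum (map (λ a → c * F a) L) ≡ c * sum (map F L)
sum-map-*ˡ c F []      = sym (ℕP.*-zeroʳ c)
sum-map-*ˡ c F (a ∷ L) = trans (cong (c * F a +_) (sum-map-*ˡ c F L)) (sym (ℕP.*-distribˡ-+ c (F a) _))

sum-map-tabulate : (h : Fin n → A) (F : A → ℕ) → sum (map F (tabulate h)) ≡ ∑[ i < n ] F (h i)
sum-map-tabulate {n = zero}  h F = refl
sum-map-tabulate {n = suc n} h F = cong (F (h Fin.zero) +_) (sum-map-tabulate (h ∘ Fin.suc) F)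

sum-map-concatMap : (F : B → ℕ) (h : A → List B) (L : List A) →
                    sum (map F (concatMap h L)) ≡ sum (map (λ a → sum (map F (h a))) L)
sum-map-concatMap F h []      = refl
sum-map-concatMap F h (a ∷ L) = begin
  sum (map F (h a ++ concatMap h L))                   ≡⟨ cong sum (map-++ F (h a) (concatMap h L)) ⟩
  sum (map F (h a) ++ map F (concatMap h L))           ≡⟨ ListSum.sum-++ (map F (h a)) _ ⟩
  sum (map F (h a)) + sum (map F (concatMap h L))      ≡⟨ cong (sum (map F (h a)) +_) (sum-map-concatMap F h L) ⟩
  sum (map F (h a)) + sum (map (λ a → sum (map F (h a))) L) ∎
  where open ≡-Reasoning

sum-map-∑ : (G : A → Fin n → ℕ) (L : List A) →
            sum (map (λ a → ∑[ x < n ] G a x) L) ≡ ∑[ x < n ] sum (map (λ a → G a x) L)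
sum-map-∑ {n = n} G []      = sym (sum-replicate-zero n)
sum-map-∑ {n = n} G (a ∷ L) =
  trans (cong (∑[ x < n ] G a x +_) (sum-map-∑ G L)) (sym (∑-distrib-+ (G a) _))

sum-map-filter : (P? : Decidable P) (u : A → ℕ) (L : List A) →
                 sum (map u (filter P? L)) ≡ sum (map (λ a → 𝟙 (P? a) * u a) L)
sum-map-filter P? u []      = refl
sum-map-filter P? u (a ∷ L) with does (P? a)
... | true  = cong₂ _+_ (sym (ℕP.+-identityʳ (u a))) (sum-map-filter P? u L)
... | false = sum-map-filter P? u L

length-filter : (P? : Decidable P) (L : List A) → length (filter P? L) ≡ sum (map (𝟙 ∘ P?) L)
length-filter P? []      = refl
length-filter P? (a ∷ L) with does (P? a)
... | true  = cong suc (length-filter P? L)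
... | false = length-filter P? L

sum-map-const : (c : ℕ) (L : List A) → sum (map (λ _ → c) L) ≡ length L * c
sum-map-const c []      = refl
sum-map-const c (a ∷ L) = cong (c +_) (sum-map-const c L)

∑-const : (n c : ℕ) → ∑[ j < n ] c ≡ n * c
∑-const zero    c = refl
∑-const (suc n) c = cong (c +_) (∑-const n c)

≤-∑ : (f : Fin n → ℕ) (i : Fin n) → f i ≤ ∑[ j < n ] f j
≤-∑ {suc n} f i = subst (f i ≤_) (sym (sum-remove f)) (ℕP.m≤m+n (f i) _)

module _ {a ℓ} (M : CommutativeMonoid a ℓ) where
  open CommutativeMonoid M using (Carrier; _≈_; _∙_; ∙-congʳ; setoid; commutativeSemigroup)
    renaming (sym to ≈-sym)
  open MonoidSum M using () renaming (sum to sumᴹ; sum-remove to sumᴹ-remove; sum-cong-≗ to sumᴹ-cong-≗)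
  open import Algebra.Properties.CommutativeSemigroup commutativeSemigroup using (xy∙z≈zy∙x)
  open import Relation.Binary.Reasoning.Setoid setoid

  sum-updateAt : (h : Fin n → B → Carrier) (m : Fin n → B) (x : Fin n) (f : B → B) →
                 sumᴹ (λ j → h j (updateAt m x f j)) ∙ h x (m x) ≈ sumᴹ (λ j → h j (m j)) ∙ h x (f (m x))
  sum-updateAt {n = suc n} h m x f = begin
    sumᴹ s ∙ t x                         ≈⟨ ∙-congʳ (sumᴹ-remove s) ⟩
    (s x ∙ sumᴹ (removeAt s x)) ∙ t x    ≡⟨ cong (λ r → (s x ∙ r) ∙ t x) (sumᴹ-cong-≗ agree) ⟩
    (s x ∙ sumᴹ (removeAt t x)) ∙ t x    ≈⟨ xy∙z≈zy∙x (s x) _ (t x) ⟩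
    (t x ∙ sumᴹ (removeAt t x)) ∙ s x    ≈⟨ ∙-congʳ (≈-sym (sumᴹ-remove t)) ⟩
    sumᴹ t ∙ s x                         ≡⟨ cong (λ b → sumᴹ t ∙ h x b) (updateAt-updates x m) ⟩
    sumᴹ t ∙ h x (f (m x))               ∎
    where
    s t : Vector Carrier (suc n)
    s j = h j (updateAt m x f j)
    t j = h j (m j)
    agree : removeAt s x ≗ removeAt t x
    agree j = cong (h (punchIn x j)) (updateAt-minimal _ x m (FinP.punchInᵢ≢i x j))

decrementAt : Fin n → (Fin n → ℕ) → Fin n → ℕ
decrementAt x m = updateAt m x pred

dot : (Fin n → ℕ) → (Fin n → ℕ) → ℕ
dot {n} m w = ∑[ j < n ] (m j * w j)

decrementAt-self : (x : Fin n) (m : Fin n → ℕ) → decrementAt x m x ≡ pred (m x)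
decrementAt-self x m = updateAt-updates x m

decrementAt-other : (x : Fin n) (m : Fin n → ℕ) {j : Fin n} → j ≢ x → decrementAt x m j ≡ m j
decrementAt-other x m {j} j≢x = updateAt-minimal j x m j≢x

module _ (m : Fin n → ℕ) {x : Fin n} .{{_ : NonZero (m x)}} where

  sum-decrementAt : suc (∑[ j < n ] decrementAt x m j) ≡ ∑[ j < n ] m j
  sum-decrementAt with m x | sum-updateAt ℕP.+-0-commutativeMonoid (λ _ k → k) m x pred
  ... | suc p | eq = ℕP.+-cancelʳ-≡ p _ _ (trans (sym (ℕP.+-suc _ p)) eq)

  dot-decrementAt : (w : Fin n → ℕ) → dot (decrementAt x m) w + w x ≡ dot m w
  dot-decrementAt w with m x | sum-updateAt ℕP.+-0-commutativeMonoid (λ j k → k * w j) m x pred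
  ... | suc p | eq = ℕP.+-cancelʳ-≡ (p * w x) _ _ (trans (ℕP.+-assoc (dot (decrementAt x m) w) (w x) _) eq)

  ∏!-decrementAt : ∏ (λ j → decrementAt x m j !) * m x ≡ ∏ (λ j → m j !)
  ∏!-decrementAt with m x | sum-updateAt ℕP.*-1-commutativeMonoid (λ _ k → k !) m x pred
  ... | suc p | eq = ℕP.*-cancelʳ-≡ _ _ (p !) {{p ℕP.!≢0}}
                       (trans (ℕP.*-assoc (∏ (λ j → decrementAt x m j !)) (suc p) (p !)) eq)

∏!≢0 : (m : Fin n → ℕ) → NonZero (∏ (λ j → m j !))
∏!≢0 {zero}  m = _
∏!≢0 {suc n} m = ℕP.m*n≢0 (m Fin.zero !) _ {{m Fin.zero ℕP.!≢0}} {{∏!≢0 (m ∘ Fin.suc)}}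

hasFiberSizes? : (m : Fin n → ℕ) (σ : Fin g → Fin n) → Dec (∀ j → fiberSize σ j ≡ m j)
hasFiberSizes? m σ = FinP.all? (λ j → fiberSize σ j ℕ.≟ m j)

fiberSize-∑ : (σ : Fin g → Fin n) (j : Fin n) → fiberSize σ j ≡ ∑[ i < g ] 𝟙 (σ i Fin.≟ j)
fiberSize-∑ {g} σ j = trans (length-filter (λ i → σ i Fin.≟ j) (allFin g))
                             (sum-map-tabulate (λ i → i) (λ i → 𝟙 (σ i Fin.≟ j)))

fiberSize-extend : (x : Fin n) (f : Fin g → Fin n) (j : Fin n) →
                   fiberSize (extend x f) j ≡ 𝟙 (x Fin.≟ j) + fiberSize f j
fiberSize-extend x f j = trans (fiberSize-∑ (extend x f) j) (cong (𝟙 (x Fin.≟ j) +_) (sym (fiberSize-∑ f j)))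

fiberSize-extend-self : (x : Fin n) (f : Fin g → Fin n) → fiberSize (extend x f) x ≡ suc (fiberSize f x)
fiberSize-extend-self x f = trans (fiberSize-extend x f x) (cong (_+ fiberSize f x) (𝟙-yes (x Fin.≟ x) refl))

fiberSize-extend-other : (x : Fin n) (f : Fin g → Fin n) {j : Fin n} → j ≢ x →
                         fiberSize (extend x f) j ≡ fiberSize f j
fiberSize-extend-other x f {j} j≢x =
  trans (fiberSize-extend x f j) (cong (_+ fiberSize f j) (𝟙-no (x Fin.≟ j) (j≢x ∘ sym)))

hasFiberSizes-extend : (m : Fin n → ℕ) (x : Fin n) (f : Fin g → Fin n) →
  𝟙 (hasFiberSizes? m (extend x f)) ≡ [ m x ≢0] * 𝟙 (hasFiberSizes? (decrementAt x m) f)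
hasFiberSizes-extend m x f with ℕP.nonZero? (m x)
... | no ¬mx≢0 = 𝟙-no (hasFiberSizes? m (extend x f))
                  (λ has → ¬mx≢0 (subst NonZero {suc (fiberSize f x)} (trans (sym (fiberSize-extend-self x f)) (has x)) _))
... | yes mx≢0 = trans (𝟙-cong forget restore (hasFiberSizes? m (extend x f)) (hasFiberSizes? (decrementAt x m) f))
                           (sym (ℕP.*-identityˡ _))
  where
  forget : (∀ j → fiberSize (extend x f) j ≡ m j) → ∀ j → fiberSize f j ≡ decrementAt x m j
  forget has j with j Fin.≟ x
  ... | yes refl = trans (cong pred (trans (sym (fiberSize-extend-self x f)) (has x))) (sym (decrementAt-self x m))
  ... | no j≢x   = trans (sym (fiberSize-extend-other x f j≢x)) (trans (has j) (sym (decrementAt-other x m j≢x)))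
  restore : (∀ j → fiberSize f j ≡ decrementAt x m j) → ∀ j → fiberSize (extend x f) j ≡ m j
  restore has j with j Fin.≟ x
  ... | yes refl = trans (fiberSize-extend-self x f)
                     (trans (cong suc (trans (has x) (decrementAt-self x m))) (ℕP.suc-pred (m x) {{mx≢0}}))
  ... | no j≢x   = trans (fiberSize-extend-other x f j≢x) (trans (has j) (decrementAt-other x m j≢x))

sum-allFuns-suc : (F : (Fin (suc g) → Fin n) → ℕ) →
                  sum (map F (allFuns (suc g) n)) ≡ ∑[ x < n ] sum (map (F ∘ extend x) (allFuns g n))
sum-allFuns-suc {g} {n} F = begin
  sum (map F (concatMap (λ f → map (λ x → extend x f) (allFin n)) (allFuns g n)))
    ≡⟨ sum-map-concatMap F _ (allFuns g n) ⟩
  sum (map (λ f → sum (map F (map (λ x → extend x f) (allFin n)))) (allFuns g n))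
    ≡⟨ sum-map-cong extensions (allFuns g n) ⟩
  sum (map (λ f → ∑[ x < n ] F (extend x f)) (allFuns g n))
    ≡⟨ sum-map-∑ (λ f x → F (extend x f)) (allFuns g n) ⟩
  ∑[ x < n ] sum (map (F ∘ extend x) (allFuns g n)) ∎
  where
  open ≡-Reasoning
  extensions : ∀ f → sum (map F (map (λ x → extend x f) (allFin n))) ≡ ∑[ x < n ] F (extend x f)
  extensions f = trans (cong (sum ∘ map F) (map-tabulate (λ x → x) (λ x → extend x f)))
                       (sum-map-tabulate (λ x → extend x f) F)

-- Σ_m for an arbitrary length g; it is empty unless Σ_j m_j = g, which lets g vary in the induction.
sigmaFuns : (g : ℕ) → (Fin n → ℕ) → List (Fin g → Fin n)
sigmaFuns {n} g m = filter (hasFiberSizes? m) (allFuns g n)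

sum-sigmaFuns-suc : (m : Fin n → ℕ) (u : (Fin (suc g) → Fin n) → ℕ) →
  sum (map u (sigmaFuns (suc g) m))
    ≡ ∑[ x < n ] ([ m x ≢0] * sum (map (u ∘ extend x) (sigmaFuns g (decrementAt x m))))
sum-sigmaFuns-suc {n} {g} m u = begin
  sum (map u (sigmaFuns (suc g) m))
    ≡⟨ sum-map-filter (hasFiberSizes? m) u (allFuns (suc g) n) ⟩
  sum (map (λ σ → 𝟙 (hasFiberSizes? m σ) * u σ) (allFuns (suc g) n))
    ≡⟨ sum-allFuns-suc (λ σ → 𝟙 (hasFiberSizes? m σ) * u σ) ⟩
  ∑[ x < n ] sum (map (λ f → 𝟙 (hasFiberSizes? m (extend x f)) * u (extend x f)) (allFuns g n))
    ≡⟨ sum-cong-≗ first-letter ⟩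
  ∑[ x < n ] ([ m x ≢0] * sum (map (u ∘ extend x) (sigmaFuns g (decrementAt x m)))) ∎
  where
  open ≡-Reasoning
  first-letter : ∀ x → sum (map (λ f → 𝟙 (hasFiberSizes? m (extend x f)) * u (extend x f)) (allFuns g n))
                     ≡ [ m x ≢0] * sum (map (u ∘ extend x) (sigmaFuns g (decrementAt x m)))
  first-letter x = begin
    sum (map (λ f → 𝟙 (hasFiberSizes? m (extend x f)) * u (extend x f)) (allFuns g n))
      ≡⟨ sum-map-cong (λ f → trans (cong (_* u (extend x f)) (hasFiberSizes-extend m x f))
                                 (ℕP.*-assoc [ m x ≢0] _ (u (extend x f)))) (allFuns g n) ⟩
    sum (map (λ f → [ m x ≢0] * (𝟙 (hasFiberSizes? (decrementAt x m) f) * u (extend x f))) (allFuns g n))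
      ≡⟨ sum-map-*ˡ [ m x ≢0] (λ f → 𝟙 (hasFiberSizes? (decrementAt x m) f) * u (extend x f)) (allFuns g n) ⟩
    [ m x ≢0] * sum (map (λ f → 𝟙 (hasFiberSizes? (decrementAt x m) f) * u (extend x f)) (allFuns g n))
      ≡⟨ cong ([ m x ≢0] *_) (sym (sum-map-filter (hasFiberSizes? (decrementAt x m)) (u ∘ extend x) (allFuns g n))) ⟩
    [ m x ≢0] * sum (map (u ∘ extend x) (sigmaFuns g (decrementAt x m))) ∎

sigmaCount : (g : ℕ) → (Fin n → ℕ) → ℕ
sigmaCount g m = length (sigmaFuns g m)

sigmaWeight : (g : ℕ) → (Fin n → ℕ) → Fin g → (Fin n → ℕ) → ℕ
sigmaWeight g m i w = sum (map (λ σ → w (σ i)) (sigmaFuns g m))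

sigmaCount-suc : (g : ℕ) (m : Fin n → ℕ) →
  sigmaCount (suc g) m ≡ ∑[ x < n ] ([ m x ≢0] * sigmaCount g (decrementAt x m))
sigmaCount-suc g m = begin
  length (sigmaFuns (suc g) m)                                     ≡⟨ length-as-sum (sigmaFuns (suc g) m) ⟩
  sum (map (λ _ → 1) (sigmaFuns (suc g) m))                        ≡⟨ sum-sigmaFuns-suc {g = g} m (λ _ → 1) ⟩
  ∑[ x < _ ] ([ m x ≢0] * sum (map (λ _ → 1) (sigmaFuns g (decrementAt x m))))
    ≡⟨ sum-cong-≗ (λ x → cong ([ m x ≢0] *_) (sym (length-as-sum (sigmaFuns g (decrementAt x m))))) ⟩
  ∑[ x < _ ] ([ m x ≢0] * sigmaCount g (decrementAt x m)) ∎
  where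
  open ≡-Reasoning
  length-as-sum : (L : List A) → length L ≡ sum (map (λ _ → 1) L)
  length-as-sum L = trans (sym (ℕP.*-identityʳ (length L))) (sym (sum-map-const 1 L))

sigmaWeight-zero : (g : ℕ) (m w : Fin n → ℕ) →
  sigmaWeight (suc g) m Fin.zero w ≡ ∑[ x < n ] ([ m x ≢0] * sigmaCount g (decrementAt x m) * w x)
sigmaWeight-zero g m w = trans (sum-sigmaFuns-suc {g = g} m (λ σ → w (σ Fin.zero)))
  (sum-cong-≗ (λ x → trans (cong ([ m x ≢0] *_) (sum-map-const (w x) (sigmaFuns g (decrementAt x m))))
                           (sym (ℕP.*-assoc [ m x ≢0] (sigmaCount g (decrementAt x m)) (w x)))))

sigmaWeight-suc : (m : Fin n → ℕ) (i : Fin g) (w : Fin n → ℕ) →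
  sigmaWeight (suc g) m (Fin.suc i) w ≡ ∑[ x < n ] ([ m x ≢0] * sigmaWeight g (decrementAt x m) i w)
sigmaWeight-suc m i w = sum-sigmaFuns-suc m (λ σ → w (σ (Fin.suc i)))

sigmaCount-empty : (m : Fin n → ℕ) → (∀ j → m j ≡ 0) → sigmaCount 0 m ≡ 1
sigmaCount-empty {n} m m≡0 =
  trans (length-filter (hasFiberSizes? m) (allFuns 0 n))
        (sum-map-cong (λ σ → 𝟙-yes (hasFiberSizes? m σ) (λ j → sym (m≡0 j))) (allFuns 0 n))

sigmaCount-≢ : (g : ℕ) (m : Fin n → ℕ) → ∑[ j < n ] m j ≢ g → sigmaCount g m ≡ 0
sigmaCount-≢ {n} zero m ∑m≢0 =
  trans (length-filter (hasFiberSizes? m) (allFuns 0 n))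
        (sum-map-cong (λ σ → 𝟙-no (hasFiberSizes? m σ) allZero) (allFuns 0 n))
  where
  allZero : ¬ (∀ j → 0 ≡ m j)
  allZero has = ∑m≢0 (trans (sym (sum-cong-≗ has)) (sum-replicate-zero n))
sigmaCount-≢ {n} (suc g) m ∑m≢1+g =
  trans (sigmaCount-suc g m) (trans (sum-cong-≗ vanishes) (sum-replicate-zero n))
  where
  vanishes : ∀ x → [ m x ≢0] * sigmaCount g (decrementAt x m) ≡ 0
  vanishes x with ℕP.nonZero? (m x)
  ... | no _     = refl
  ... | yes mx≢0 = trans (ℕP.*-identityˡ _)
                     (sigmaCount-≢ g (decrementAt x m)
                       (λ e → ∑m≢1+g (trans (sym (sum-decrementAt m {{mx≢0}})) (cong suc e))))

mutual
  sigmaCount-multinomial : (g : ℕ) (m : Fin n → ℕ) → ∑[ j < n ] m j ≡ g →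
                           sigmaCount g m * ∏ (λ j → m j !) ≡ g !
  sigmaCount-multinomial {n} zero m ∑m≡0 =
    cong₂ _*_ (sigmaCount-empty m m≡0) (trans (∏-cong-≗ (λ j → cong _! (m≡0 j))) (∏-replicate-1 n))
    where
    m≡0 : ∀ j → m j ≡ 0
    m≡0 j = ℕP.n≤0⇒n≡0 (subst (m j ≤_) ∑m≡0 (≤-∑ m j))
  sigmaCount-multinomial {n} (suc g) m ∑m≡1+g = begin
    sigmaCount (suc g) m * ∏ (λ j → m j !)
      ≡⟨ cong (_* ∏ (λ j → m j !)) (sigmaCount-suc g m) ⟩
    (∑[ x < n ] ([ m x ≢0] * sigmaCount g (decrementAt x m))) * ∏ (λ j → m j !)
      ≡⟨ *-distribʳ-sum (∏ (λ j → m j !)) (λ x → [ m x ≢0] * sigmaCount g (decrementAt x m)) ⟩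
    ∑[ x < n ] ([ m x ≢0] * sigmaCount g (decrementAt x m) * ∏ (λ j → m j !))
      ≡⟨ sum-cong-≗ term ⟩
    ∑[ x < n ] (m x * g !)
      ≡⟨ *-distribʳ-sum (g !) m ⟨
    (∑[ x < n ] m x) * g !
      ≡⟨ cong (_* g !) ∑m≡1+g ⟩
    suc g * g ! ∎
    where
    open ≡-Reasoning
    term : ∀ x → [ m x ≢0] * sigmaCount g (decrementAt x m) * ∏ (λ j → m j !) ≡ m x * g !
    term x with ℕP.nonZero? (m x)
    ... | no ¬mx≢0 = cong (_* g !) (sym (¬NonZero⇒≡0 ¬mx≢0))
    ... | yes mx≢0 = trans (cong (_* ∏ (λ j → m j !)) (ℕP.*-identityˡ (sigmaCount g (decrementAt x m))))
                       (trans (sigmaCount-decrementAt-∏! g m {{mx≢0}} ∑m≡1+g) (ℕP.*-comm (g !) (m x)))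

  sigmaCount-decrementAt-∏! : (g : ℕ) (m : Fin n → ℕ) {x : Fin n} .{{_ : NonZero (m x)}} →
    ∑[ j < n ] m j ≡ suc g → sigmaCount g (decrementAt x m) * ∏ (λ j → m j !) ≡ g ! * m x
  sigmaCount-decrementAt-∏! {n} g m {x} ∑m≡1+g = begin
    S * ∏ (λ j → m j !)                          ≡⟨ cong (S *_) (∏!-decrementAt m) ⟨
    S * (∏ (λ j → decrementAt x m j !) * m x)    ≡⟨ ℕP.*-assoc S _ (m x) ⟨
    S * ∏ (λ j → decrementAt x m j !) * m x
      ≡⟨ cong (_* m x) (sigmaCount-multinomial g (decrementAt x m) ∑dec≡g) ⟩
    g ! * m x ∎
    where
    open ≡-Reasoning
    S = sigmaCount g (decrementAt x m)
    ∑dec≡g : ∑[ j < n ] decrementAt x m j ≡ g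
    ∑dec≡g = ℕP.suc-injective (trans (sum-decrementAt m) ∑m≡1+g)

sigmaCount-decrementAt : (g : ℕ) (m : Fin n → ℕ) (x : Fin n) →
  suc g * ([ m x ≢0] * sigmaCount g (decrementAt x m)) ≡ m x * sigmaCount (suc g) m
sigmaCount-decrementAt {n} g m x with ℕP.nonZero? (m x)
... | no ¬mx≢0 = trans (ℕP.*-zeroʳ (suc g)) (cong (_* sigmaCount (suc g) m) (sym (¬NonZero⇒≡0 ¬mx≢0)))
... | yes mx≢0 with ∑[ j < n ] m j ℕ.≟ suc g
...   | no ∑m≢1+g = begin
  suc g * (1 * sigmaCount g (decrementAt x m))
    ≡⟨ cong (λ s → suc g * (1 * s)) (sigmaCount-≢ g (decrementAt x m) ∑dec≢g) ⟩
  suc g * 0                                    ≡⟨ ℕP.*-zeroʳ (suc g) ⟩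
  0                                            ≡⟨ ℕP.*-zeroʳ (m x) ⟨
  m x * 0                                      ≡⟨ cong (m x *_) (sigmaCount-≢ (suc g) m ∑m≢1+g) ⟨
  m x * sigmaCount (suc g) m                   ∎
  where
  open ≡-Reasoning
  ∑dec≢g : ∑[ j < n ] decrementAt x m j ≢ g
  ∑dec≢g e = ∑m≢1+g (trans (sym (sum-decrementAt m {{mx≢0}})) (cong suc e))
...   | yes ∑m≡1+g = ℕP.*-cancelʳ-≡ _ _ (∏ (λ j → m j !)) {{∏!≢0 m}} (begin
  suc g * (1 * S′) * Π!   ≡⟨ cong (λ s → suc g * s * Π!) (ℕP.*-identityˡ S′) ⟩
  suc g * S′ * Π!         ≡⟨ ℕP.*-assoc (suc g) S′ Π! ⟩
  suc g * (S′ * Π!)       ≡⟨ cong (suc g *_) (sigmaCount-decrementAt-∏! g m {{mx≢0}} ∑m≡1+g) ⟩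
  suc g * (g ! * m x)     ≡⟨ ℕP.*-assoc (suc g) (g !) (m x) ⟨
  suc g ! * m x           ≡⟨ cong (_* m x) (sigmaCount-multinomial (suc g) m ∑m≡1+g) ⟨
  S * Π! * m x            ≡⟨ xy∙z≈zx∙y S Π! (m x) ⟩
  m x * S * Π!            ∎)
  where
  open ≡-Reasoning
  S′ = sigmaCount g (decrementAt x m)
  S = sigmaCount (suc g) m
  Π! = ∏ (λ j → m j !)

sigmaWeight-zero-identity : (g : ℕ) (m w : Fin n → ℕ) →
  suc g * sigmaWeight (suc g) m Fin.zero w ≡ dot m w * sigmaCount (suc g) m
sigmaWeight-zero-identity {n} g m w = begin
  suc g * sigmaWeight (suc g) m Fin.zero w           ≡⟨ cong (suc g *_) (sigmaWeight-zero g m w) ⟩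
  suc g * ∑[ x < n ] (count′ x * w x)                ≡⟨ *-distribˡ-sum (suc g) (λ x → count′ x * w x) ⟩
  ∑[ x < n ] (suc g * (count′ x * w x))              ≡⟨ sum-cong-≗ term ⟩
  ∑[ x < n ] (m x * w x * S)                         ≡⟨ *-distribʳ-sum S (λ x → m x * w x) ⟨
  dot m w * S                                        ∎
  where
  open ≡-Reasoning
  S = sigmaCount (suc g) m
  count′ : Fin n → ℕ
  count′ x = [ m x ≢0] * sigmaCount g (decrementAt x m)
  term : ∀ x → suc g * (count′ x * w x) ≡ m x * w x * S
  term x = trans (sym (ℕP.*-assoc (suc g) (count′ x) (w x)))
                 (trans (cong (_* w x) (sigmaCount-decrementAt g m x)) (xy∙z≈xz∙y (m x) S (w x)))

sigmaWeight-suc-step : (g : ℕ) (m : Fin n → ℕ) (i : Fin g) (w : Fin n → ℕ) →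
  (∀ m′ → g * sigmaWeight g m′ i w ≡ dot m′ w * sigmaCount g m′) →
  g * sigmaWeight (suc g) m (Fin.suc i) w + sigmaWeight (suc g) m Fin.zero w ≡ dot m w * sigmaCount (suc g) m
sigmaWeight-suc-step {n} g m i w ih = begin
  g * sigmaWeight (suc g) m (Fin.suc i) w + sigmaWeight (suc g) m Fin.zero w
    ≡⟨ cong₂ _+_ (cong (g *_) (sigmaWeight-suc m i w)) (sigmaWeight-zero g m w) ⟩
  g * ∑[ x < n ] ([ m x ≢0] * W′ x) + ∑[ x < n ] ([ m x ≢0] * S′ x * w x)
    ≡⟨ cong (_+ ∑[ x < n ] ([ m x ≢0] * S′ x * w x))
            (trans (*-distribˡ-sum g (λ x → [ m x ≢0] * W′ x)) (sum-cong-≗ by-ih)) ⟩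
  ∑[ x < n ] ([ m x ≢0] * (dot (decrementAt x m) w * S′ x)) + ∑[ x < n ] ([ m x ≢0] * S′ x * w x)
    ≡⟨ ∑-distrib-+ (λ x → [ m x ≢0] * (dot (decrementAt x m) w * S′ x)) (λ x → [ m x ≢0] * S′ x * w x) ⟨
  ∑[ x < n ] ([ m x ≢0] * (dot (decrementAt x m) w * S′ x) + [ m x ≢0] * S′ x * w x)
    ≡⟨ sum-cong-≗ term ⟩
  ∑[ x < n ] (dot m w * ([ m x ≢0] * S′ x))
    ≡⟨ *-distribˡ-sum (dot m w) (λ x → [ m x ≢0] * S′ x) ⟨
  dot m w * ∑[ x < n ] ([ m x ≢0] * S′ x)
    ≡⟨ cong (dot m w *_) (sigmaCount-suc g m) ⟨
  dot m w * sigmaCount (suc g) m ∎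
  where
  open ≡-Reasoning
  open +-*-Solver using (solve; _:+_; _:*_; _:=_; con)
  S′ W′ : Fin n → ℕ
  S′ x = sigmaCount g (decrementAt x m)
  W′ x = sigmaWeight g (decrementAt x m) i w
  by-ih : ∀ x → g * ([ m x ≢0] * W′ x) ≡ [ m x ≢0] * (dot (decrementAt x m) w * S′ x)
  by-ih x = trans (x∙yz≈y∙xz g [ m x ≢0] (W′ x)) (cong ([ m x ≢0] *_) (ih (decrementAt x m)))
  term : ∀ x → [ m x ≢0] * (dot (decrementAt x m) w * S′ x) + [ m x ≢0] * S′ x * w x ≡ dot m w * ([ m x ≢0] * S′ x)
  term x with ℕP.nonZero? (m x)
  ... | no _     = sym (ℕP.*-zeroʳ (dot m w))
  ... | yes mx≢0 = trans
    (solve 3 (λ d s v → con 1 :* (d :* s) :+ con 1 :* s :* v := (d :+ v) :* (con 1 :* s)) refl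
      (dot (decrementAt x m) w) (S′ x) (w x))
    (cong (_* (1 * S′ x)) (dot-decrementAt m {{mx≢0}} w))

sigmaWeight-identity : (g : ℕ) (m : Fin n → ℕ) (i : Fin g) (w : Fin n → ℕ) →
  g * sigmaWeight g m i w ≡ dot m w * sigmaCount g m
sigmaWeight-identity (suc g) m Fin.zero    w = sigmaWeight-zero-identity g m w
sigmaWeight-identity (suc (suc g)) m (Fin.suc i) w = begin
  suc (suc g) * W                         ≡⟨ cong (suc (suc g) *_) W≡W₀ ⟩
  suc (suc g) * W₀                        ≡⟨ sigmaWeight-zero-identity (suc g) m w ⟩
  dot m w * sigmaCount (suc (suc g)) m    ∎
  where
  open ≡-Reasoning
  W W₀ : ℕ
  W  = sigmaWeight (suc (suc g)) m (Fin.suc i) w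
  W₀ = sigmaWeight (suc (suc g)) m Fin.zero w
  -- Every row carries the same weight: compare the inductive step with the identity for row 0.
  W≡W₀ : W ≡ W₀
  W≡W₀ = ℕP.*-cancelˡ-≡ W W₀ (suc g) (ℕP.+-cancelʳ-≡ W₀ (suc g * W) (suc g * W₀) (begin
    suc g * W + W₀
      ≡⟨ sigmaWeight-suc-step (suc g) m i w (λ m′ → sigmaWeight-identity (suc g) m′ i w) ⟩
    dot m w * sigmaCount (suc (suc g)) m    ≡⟨ sigmaWeight-zero-identity (suc g) m w ⟨
    W₀ + suc g * W₀                         ≡⟨ ℕP.+-comm W₀ (suc g * W₀) ⟩
    suc g * W₀ + W₀                         ∎))

fromℚᵘ-homo-+ : ∀ p q → fromℚᵘ (p ℚᵘ.+ q) ≡ fromℚᵘ p ℚ.+ fromℚᵘ q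
fromℚᵘ-homo-+ p q = ℚP.toℚᵘ-injective (ℚᵘP.≃-trans (ℚP.toℚᵘ-fromℚᵘ (p ℚᵘ.+ q))
  (ℚᵘP.≃-trans (ℚᵘP.+-cong (ℚᵘP.≃-sym (ℚP.toℚᵘ-fromℚᵘ p)) (ℚᵘP.≃-sym (ℚP.toℚᵘ-fromℚᵘ q)))
               (ℚᵘP.≃-sym (ℚP.toℚᵘ-homo-+ (fromℚᵘ p) (fromℚᵘ q)))))

fromℚᵘ-homo-* : ∀ p q → fromℚᵘ (p ℚᵘ.* q) ≡ fromℚᵘ p ℚ.* fromℚᵘ q
fromℚᵘ-homo-* p q = ℚP.toℚᵘ-injective (ℚᵘP.≃-trans (ℚP.toℚᵘ-fromℚᵘ (p ℚᵘ.* q))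
  (ℚᵘP.≃-trans (ℚᵘP.*-cong (ℚᵘP.≃-sym (ℚP.toℚᵘ-fromℚᵘ p)) (ℚᵘP.≃-sym (ℚP.toℚᵘ-fromℚᵘ q)))
               (ℚᵘP.≃-sym (ℚP.toℚᵘ-homo-* (fromℚᵘ p) (fromℚᵘ q)))))

fromℕ-+ : ∀ x y → fromℕ (x + y) ≡ fromℕ x ℚ.+ fromℕ y
fromℕ-+ x y = trans
  (ℚP.fromℚᵘ-cong {mkℚᵘ (ℤ.+ (x + y)) 0} {mkℚᵘ (ℤ.+ x) 0 ℚᵘ.+ mkℚᵘ (ℤ.+ y) 0} (*≡* (cong (ℤ._* ℤ.+ 1)
    (trans (ℤP.pos-+ x y) (sym (cong₂ ℤ._+_ (ℤP.*-identityʳ (ℤ.+ x)) (ℤP.*-identityʳ (ℤ.+ y))))))))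
  (fromℚᵘ-homo-+ (mkℚᵘ (ℤ.+ x) 0) (mkℚᵘ (ℤ.+ y) 0))

divℕ-*-fromℕ : ∀ γ D .{{_ : NonZero D}} W S → γ * W ≡ D * S → divℕ γ D ℚ.* fromℕ W ≡ fromℕ S
divℕ-*-fromℕ γ (suc d) W S eq = trans (sym (fromℚᵘ-homo-* (mkℚᵘ (ℤ.+ γ) d) (mkℚᵘ (ℤ.+ W) 0)))
  (ℚP.fromℚᵘ-cong {mkℚᵘ (ℤ.+ γ) d ℚᵘ.* mkℚᵘ (ℤ.+ W) 0} {mkℚᵘ (ℤ.+ S) 0} (*≡* (begin
    ℤ.+ γ ℤ.* ℤ.+ W ℤ.* ℤ.+ 1    ≡⟨ ℤP.*-identityʳ (ℤ.+ γ ℤ.* ℤ.+ W) ⟩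
    ℤ.+ γ ℤ.* ℤ.+ W              ≡⟨ ℤP.pos-* γ W ⟨
    ℤ.+ (γ * W)                  ≡⟨ cong ℤ.+_ (trans eq (ℕP.*-comm (suc d) S)) ⟩
    ℤ.+ (S * suc d)              ≡⟨ cong (λ e → ℤ.+ (S * suc e)) (ℕP.*-identityʳ d) ⟨
    ℤ.+ (S * suc (d * 1))        ≡⟨ ℤP.pos-* S (suc (d * 1)) ⟩
    ℤ.+ S ℤ.* ℤ.+ suc (d * 1)    ∎)))
  where open ≡-Reasoning

fromℕ≡divℕ : ∀ x γ D .{{_ : NonZero D}} → x * D ≡ γ → fromℕ x ≡ divℕ γ D
fromℕ≡divℕ x γ (suc d) eq = ℚP.fromℚᵘ-cong {mkℚᵘ (ℤ.+ x) 0} {mkℚᵘ (ℤ.+ γ) d}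
  (*≡* (trans (sym (ℤP.pos-* x (suc d))) (trans (cong ℤ.+_ eq) (sym (ℤP.*-identityʳ (ℤ.+ γ))))))

sumℚ-affine : (a : ℚ) (u : A → ℕ) (K : List A) →
  sumℚ (map (λ σ → 1ℚ ℚ.- a ℚ.* fromℕ (u σ)) K) ≡ fromℕ (length K) ℚ.- a ℚ.* fromℕ (sum (map u K))
sumℚ-affine a u []      = sym (cong (λ p → 0ℚ ℚ.- p) (ℚP.*-zeroʳ a))
sumℚ-affine a u (σ ∷ K) = begin
  (1ℚ ℚ.- a ℚ.* U) ℚ.+ sumℚ (map (λ σ → 1ℚ ℚ.- a ℚ.* fromℕ (u σ)) K)
    ≡⟨ cong ((1ℚ ℚ.- a ℚ.* U) ℚ.+_) (sumℚ-affine a u K) ⟩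
  (1ℚ ℚ.- a ℚ.* U) ℚ.+ (L ℚ.- a ℚ.* T)
    ≡⟨ solve 4 (λ a U L T → (con 1ℚ :- a :* U) :+ (L :- a :* T) := (con 1ℚ :+ L) :- a :* (U :+ T)) refl a U L T ⟩
  (1ℚ ℚ.+ L) ℚ.- a ℚ.* (U ℚ.+ T)
    ≡⟨ cong₂ (λ c s → c ℚ.- a ℚ.* s) (fromℕ-+ 1 (length K)) (fromℕ-+ (u σ) (sum (map u K))) ⟨
  fromℕ (suc (length K)) ℚ.- a ℚ.* fromℕ (u σ + sum (map u K)) ∎
  where
  open ≡-Reasoning
  open ℚ-Solver using (solve; _:+_; _:*_; _:-_; _:=_; con)
  U L T : ℚ
  U = fromℕ (u σ)
  L = fromℕ (length K)
  T = fromℕ (sum (map u K))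

prodℚ-tabulate-≡1 : (h : Fin n → ℚ) → (∀ i → h i ≡ 1ℚ) → prodℚ (tabulate h) ≡ 1ℚ
prodℚ-tabulate-≡1 {zero}  h h≡1 = refl
prodℚ-tabulate-≡1 {suc n} h h≡1 =
  cong₂ ℚ._*_ (h≡1 Fin.zero) (prodℚ-tabulate-≡1 (h ∘ Fin.suc) (h≡1 ∘ Fin.suc))

prodℚ-tabulate-single : (h : Fin n → ℚ) (i₀ : Fin n) → (∀ i → i ≢ i₀ → h i ≡ 1ℚ) →
                        prodℚ (tabulate h) ≡ h i₀
prodℚ-tabulate-single h Fin.zero h≡1 =
  trans (cong (h Fin.zero ℚ.*_) (prodℚ-tabulate-≡1 (h ∘ Fin.suc) (λ i → h≡1 (Fin.suc i) (λ ()))))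
        (ℚP.*-identityʳ (h Fin.zero))
prodℚ-tabulate-single h (Fin.suc i₀) h≡1 =
  trans (cong₂ ℚ._*_ (h≡1 Fin.zero (λ ()))
                     (prodℚ-tabulate-single (h ∘ Fin.suc) i₀ (λ i i≢i₀ → h≡1 (Fin.suc i) (i≢i₀ ∘ FinP.suc-injective))))
        (ℚP.*-identityˡ (h (Fin.suc i₀)))

module _ (m : Fin n → ℕ) (X : Fin (gamma m) → Fin n → ℚ) (i₀ : Fin (gamma m)) (w : Fin n → ℕ)
         (otherRows : ∀ i j → i ≢ i₀ → X i j ≡ 1ℚ) where

  mperm-affineRow : (a : ℚ) → (∀ j → X i₀ j ≡ 1ℚ ℚ.- a ℚ.* fromℕ (w j)) →
    mperm m X ≡ fromℕ (sigmaCount (gamma m) m) ℚ.- a ℚ.* fromℕ (sigmaWeight (gamma m) m i₀ w)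
  mperm-affineRow a row =
    trans (cong sumℚ (map-cong rowProduct (SigmaM m))) (sumℚ-affine a (λ σ → w (σ i₀)) (SigmaM m))
    where
    rowProduct : ∀ σ → prodℚ (map (λ i → X i (σ i)) (allFin (gamma m))) ≡ 1ℚ ℚ.- a ℚ.* fromℕ (w (σ i₀))
    rowProduct σ = trans (cong prodℚ (map-tabulate (λ i → i) (λ i → X i (σ i))))
      (trans (prodℚ-tabulate-single (λ i → X i (σ i)) i₀ (λ i i≢i₀ → otherRows i (σ i) i≢i₀)) (row (σ i₀)))

  mperm-vanishes : (D : ℕ) .{{_ : NonZero D}} → dot m w ≡ D →
    (∀ j → X i₀ j ≡ 1ℚ ℚ.- divℕ (gamma m) D ℚ.* fromℕ (w j)) → mperm m X ≡ 0ℚ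
  mperm-vanishes D dot≡D row = begin
    mperm m X                                    ≡⟨ mperm-affineRow (divℕ (gamma m) D) row ⟩
    fromℕ S ℚ.- divℕ (gamma m) D ℚ.* fromℕ W
      ≡⟨ cong (λ p → fromℕ S ℚ.- p) (divℕ-*-fromℕ (gamma m) D W S γW≡DS) ⟩
    fromℕ S ℚ.- fromℕ S                          ≡⟨ ℚP.+-inverseʳ (fromℕ S) ⟩
    0ℚ                                           ∎
    where
    open ≡-Reasoning
    S = sigmaCount (gamma m) m
    W = sigmaWeight (gamma m) m i₀ w
    γW≡DS : gamma m * W ≡ D * S
    γW≡DS = trans (sigmaWeight-identity (gamma m) m i₀ w) (cong (_* S) dot≡D)

1-*𝟙-yes : (a : ℚ) (d : Dec A) → A → 1ℚ ℚ.- a ℚ.* fromℕ (𝟙 d) ≡ 1ℚ ℚ.- a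
1-*𝟙-yes a d x = trans (cong (λ b → 1ℚ ℚ.- a ℚ.* fromℕ b) (𝟙-yes d x))
                       (cong (λ p → 1ℚ ℚ.- p) (ℚP.*-identityʳ a))

1-*𝟙-no : (a : ℚ) (d : Dec A) → ¬ A → 1ℚ ℚ.- a ℚ.* fromℕ (𝟙 d) ≡ 1ℚ
1-*𝟙-no a d ¬x = trans (cong (λ b → 1ℚ ℚ.- a ℚ.* fromℕ b) (𝟙-no d ¬x))
                       (cong (λ p → 1ℚ ℚ.- p) (ℚP.*-zeroʳ a))

module _ (m : Fin n → ℕ) (k : Fin n) {i : Fin (gamma m)} {j : Fin n} where

  B1-otherRow : suc (toℕ i) ≢ gamma m → B1 m k i j ≡ 1ℚ
  B1-otherRow notLast with (suc (toℕ i) ℕ.≟ gamma m) ×-dec (m j ℕ.≟ m k)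
  ... | yes (last , _) = contradiction last notLast
  ... | no _           = refl

  B1-lastRow : suc (toℕ i) ≡ gamma m →
    B1 m k i j ≡ 1ℚ ℚ.- divℕ (gamma m) (cCount m k * m k) ℚ.* fromℕ (𝟙 (m j ℕ.≟ m k))
  B1-lastRow last with suc (toℕ i) ℕ.≟ gamma m | m j ℕ.≟ m k
  ... | no notLast | _       = contradiction last notLast
  ... | yes _      | yes eq  = sym (1-*𝟙-yes (divℕ (gamma m) (cCount m k * m k)) (m j ℕ.≟ m k) eq)
  ... | yes _      | no neq  = sym (1-*𝟙-no (divℕ (gamma m) (cCount m k * m k)) (m j ℕ.≟ m k) neq)

module _ (m : Fin n → ℕ) {i : Fin (gamma m)} {j : Fin n} where

  B2-otherRow : toℕ i ≢ 0 → B2 m i j ≡ 1ℚ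
  B2-otherRow notFirst with (toℕ i ℕ.≟ 0) ×-dec (toℕ j ℕ.≟ 0)
  ... | yes (first , _) = contradiction first notFirst
  ... | no _            = refl

  B2-firstRow : toℕ i ≡ 0 → B2 m i j ≡ 1ℚ ℚ.- fromℕ n ℚ.* fromℕ (𝟙 (toℕ j ℕ.≟ 0))
  B2-firstRow first with toℕ i ℕ.≟ 0 | toℕ j ℕ.≟ 0
  ... | no notFirst | _       = contradiction first notFirst
  ... | yes _       | yes j≡0 = sym (1-*𝟙-yes (fromℕ n) (toℕ j ℕ.≟ 0) j≡0)
  ... | yes _       | no j≢0  = sym (1-*𝟙-no (fromℕ n) (toℕ j ℕ.≟ 0) j≢0)

gamma-∑ : (m : Fin n → ℕ) → gamma m ≡ ∑[ j < n ] m j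
gamma-∑ m = sum-map-tabulate (λ j → j) m

firstIndex : (g : ℕ) .{{_ : NonZero g}} → Σ (Fin g) (λ i → toℕ i ≡ 0)
firstIndex (suc g) = Fin.zero , refl

lastIndex : (g : ℕ) .{{_ : NonZero g}} → Σ (Fin g) (λ i → suc (toℕ i) ≡ g)
lastIndex (suc g) = Fin.fromℕ g , cong suc (FinP.toℕ-fromℕ g)

module _ (m : Fin n → ℕ) (k : Fin n) where

  cCount-∑ : cCount m k ≡ ∑[ j < n ] 𝟙 (m j ℕ.≟ m k)
  cCount-∑ = trans (length-filter (λ j → m j ℕ.≟ m k) (allFin n))
                   (sum-map-tabulate (λ j → j) (λ j → 𝟙 (m j ℕ.≟ m k)))

  dot-levelSet : dot m (λ j → 𝟙 (m j ℕ.≟ m k)) ≡ cCount m k * m k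
  dot-levelSet = begin
    ∑[ j < n ] (m j * 𝟙 (m j ℕ.≟ m k))    ≡⟨ sum-cong-≗ (λ j → scale (m j ℕ.≟ m k)) ⟩
    ∑[ j < n ] (𝟙 (m j ℕ.≟ m k) * m k)    ≡⟨ *-distribʳ-sum (m k) (λ j → 𝟙 (m j ℕ.≟ m k)) ⟨
    (∑[ j < n ] 𝟙 (m j ℕ.≟ m k)) * m k    ≡⟨ cong (_* m k) cCount-∑ ⟨
    cCount m k * m k                      ∎
    where
    open ≡-Reasoning
    scale : ∀ {j} (d : Dec (m j ≡ m k)) → m j * 𝟙 d ≡ 𝟙 d * m k
    scale {j} (yes mj≡mk) = trans (ℕP.*-identityʳ (m j)) (trans mj≡mk (sym (ℕP.+-identityʳ (m k))))
    scale {j} (no _)      = ℕP.*-zeroʳ (m j)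

mperm-B1≡0 : (m : Fin n → ℕ) → ¬ AllEqual m → (k : Fin n) → (∀ j → m j ≤ m k) → mperm m (B1 m k) ≡ 0ℚ
mperm-B1≡0 {n} m notAllEqual k maximal =
  mperm-vanishes m (B1 m k) last (λ j → 𝟙 (m j ℕ.≟ m k)) otherRows
    (cCount m k * m k) {{ℕP.m*n≢0 _ _ {{c≢0}} {{mk≢0}}}} (dot-levelSet m k) (λ j → B1-lastRow m k last≡γ)
  where
  mk≢0 : NonZero (m k)
  mk≢0 = ℕ.≢-nonZero (λ mk≡0 → notAllEqual (λ i j → trans (vanish mk≡0 i) (sym (vanish mk≡0 j))))
    where
    vanish : m k ≡ 0 → ∀ i → m i ≡ 0
    vanish mk≡0 i = ℕP.n≤0⇒n≡0 (subst (m i ≤_) mk≡0 (maximal i))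
  c≢0 : NonZero (cCount m k)
  c≢0 = ℕ.>-nonZero (subst (1 ≤_) (sym (cCount-∑ m k))
          (subst (_≤ ∑[ j < n ] 𝟙 (m j ℕ.≟ m k)) (𝟙-yes (m k ℕ.≟ m k) refl)
            (≤-∑ (λ j → 𝟙 (m j ℕ.≟ m k)) k)))
  instance
    γ≢0 : NonZero (gamma m)
    γ≢0 = ℕ.>-nonZero (ℕP.≤-trans (ℕ.>-nonZero⁻¹ (m k) {{mk≢0}})
                                   (subst (m k ≤_) (sym (gamma-∑ m)) (≤-∑ m k)))
  last = proj₁ (lastIndex (gamma m))
  last≡γ = proj₂ (lastIndex (gamma m))
  otherRows : ∀ i j → i ≢ last → B1 m k i j ≡ 1ℚ
  otherRows i j i≢last =
    B1-otherRow m k (λ e → i≢last (FinP.toℕ-injective (ℕP.suc-injective (trans e (sym last≡γ)))))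

mperm-B2≡0 : (m : Fin n → ℕ) (μ : ℕ) → 1 ≤ μ → 1 ≤ n → (∀ j → m j ≡ μ) → mperm m (B2 m) ≡ 0ℚ
mperm-B2≡0 {suc n} m μ 1≤μ _ m≡μ =
  mperm-vanishes m (B2 m) first w otherRows μ dot≡μ
    (λ j → trans (B2-firstRow m first≡0)
                 (cong (λ a → 1ℚ ℚ.- a ℚ.* fromℕ (w j)) (fromℕ≡divℕ (suc n) (gamma m) μ (sym γ≡nμ))))
  where
  w : Fin (suc n) → ℕ
  w j = 𝟙 (toℕ j ℕ.≟ 0)
  γ≡nμ : gamma m ≡ suc n * μ
  γ≡nμ = trans (gamma-∑ m) (trans (sum-cong-≗ m≡μ) (∑-const (suc n) μ))
  dot≡μ : dot m w ≡ μ
  dot≡μ = trans (cong₂ _+_ (trans (ℕP.*-identityʳ (m Fin.zero)) (m≡μ Fin.zero))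
                           (trans (sum-cong-≗ (λ j → ℕP.*-zeroʳ (m (Fin.suc j)))) (sum-replicate-zero n)))
                (ℕP.+-identityʳ μ)
  instance
    μ≢0 : NonZero μ
    μ≢0 = ℕ.>-nonZero 1≤μ
    γ≢0 : NonZero (gamma m)
    γ≢0 = subst NonZero (sym γ≡nμ) (ℕP.m*n≢0 (suc n) μ)
  first = proj₁ (firstIndex (gamma m))
  first≡0 = proj₂ (firstIndex (gamma m))
  otherRows : ∀ i j → i ≢ first → B2 m i j ≡ 1ℚ
  otherRows i j i≢first = B2-otherRow m (λ e → i≢first (FinP.toℕ-injective (trans e (sym first≡0))))

proposition3p11 : (n : ℕ) (m : Fin n → ℕ) →
    ((¬ AllEqual m) → (k : Fin n) → (∀ j → m j ≤ m k) → mperm m (B1 m k) ≡ 0ℚ)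
    × ((μ : ℕ) → 1 ≤ μ → 1 ≤ n → (∀ j → m j ≡ μ) → mperm m (B2 m) ≡ 0ℚ)
proposition3p11 n m = mperm-B1≡0 m , mperm-B2≡0 m
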